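{- Let $G$ be a bipartite graph with vertex set $V=V_1\sqcup V_2$ and edge set $E=E_{1,2}\sqcup E_{2,1}\subseteq V_1\times V_2$, and assume every vertex of $V$ is an extremity of at least one edge in $E_{1,2}$. Then $N_G$ belongs to $\mathrm{Sol}'$.
   Context: For such $G$, a function $r:V\to\mathbb{Z}_{>0}$ satisfies the order condition if $r(v_1)\le r(v_2)$ for each $(v_1,v_2)\in E_{1,2}$ and $r(v_2)<r(v_1)$ for each $(v_1,v_2)\in E_{2,1}$. $N_G$ is the sequence $(N_{G,m})_{m\ge0}$ with $N_{G,m}=\sum_r\prod_{v_1\in V_1}p_{r(v_1)}\prod_{v_2\in V_2}q_{r(v_2)}$, the sum over $r:V\to\{1,\dots,m\}$ satisfying the order condition. Stable polynomials in $\mathbf{p},\mathbf{q}$: $h=(h_m)_{m\ge0}$, $h_m\in\mathbb{C}[p_1,\dots,p_m,q_1,\dots,q_m]$, of bounded degree, with $h_{m+1}(p_1,\dots,p_m,0;q_1,\dots,q_m,0)=h_m$. $\mathrm{Sol}'$ is the set of such $h$ satisfying for all $m\ge1$, $1\le i\le m$: (Q) $h_m|_{q_i=0}=h_{m-1}(p_1,\dots,p_{i-1},p_i+p_{i+1},p_{i+2},\dots,p_m;q_1,\dots,q_{i-1},q_{i+1},\dots,q_m)$ if $i<m$, and $h_m|_{q_m=0}=h_{m-1}(p_1,\dots,p_{m-1};q_1,\dots,q_{m-1})$; (P) $h_m|_{p_i=0}=h_{m-1}(p_1,\dots,p_{i-1},p_{i+1},\dots,p_m;q_1,\dots,q_{i-2},q_{i-1}+q_i,q_{i+1},\dots,q_m)$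 if $i>1$, and $h_m|_{p_1=0}=h_{m-1}(p_2,\dots,p_m;q_2,\dots,q_m)$. -}

module Defs where

open import Level using (0ℓ)
open import Data.Bool using (Bool; true; false; _∧_; if_then_else_; not)
open import Data.Nat using (ℕ; zero; suc; _≤_; _≤ᵇ_; _<ᵇ_; _⊔_)
open import Data.Fin using (Fin; zero; suc; toℕ; inject₁; fromℕ; punchIn; _≟_)
open import Data.List using (List; []; _∷_; map; foldr; concatMap; filterᵇ; allFin; length; _++_)
open import Data.Product using (Σ; ∃; ∃-syntax; _×_; _,_)
open import Relation.Binary.PropositionalEquality using (_≡_)
open import Relation.Nullary using (does)
open import Algebra.Bundles using (CommutativeRing)

record BipGraph : Set where
  field
    n₁ n₂ : ℕ
    E₁₂ E₂₁ : Fin n₁ → Fin n₂ → Bool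
    disjoint : ∀ a b → E₁₂ a b ≡ true → E₂₁ a b ≡ false

open BipGraph public

EveryVertexInE₁₂ : BipGraph → Set
EveryVertexInE₁₂ G =
  ((v₁ : Fin (n₁ G)) → ∃[ v₂ ] E₁₂ G v₁ v₂ ≡ true) ×
  ((v₂ : Fin (n₂ G)) → ∃[ v₁ ] E₁₂ G v₁ v₂ ≡ true)

-- Index k : Fin m stands for p_{k+1}/q_{k+1}.

data Var (m : ℕ) : Set where
  pv : Fin m → Var m
  qv : Fin m → Var m

Monomial : ℕ → Set
Monomial m = List (Var m)

Poly : ℕ → Set
Poly m = List (Monomial m)

deg : ∀ {m} → Poly m → ℕ
deg = foldr (λ mon d → length mon ⊔ d) 0

module _ (R : CommutativeRing 0ℓ 0ℓ) where
  open CommutativeRing R using (Carrier; _+_; _*_; 0#; 1#; _≈_)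

  evalVar : ∀ {m} → (Fin m → Carrier) → (Fin m → Carrier) → Var m → Carrier
  evalVar p q (pv i) = p i
  evalVar p q (qv i) = q i

  evalMon : ∀ {m} → (Fin m → Carrier) → (Fin m → Carrier) → Monomial m → Carrier
  evalMon p q = foldr (λ x acc → evalVar p q x * acc) 1#

  eval : ∀ {m} → Poly m → (Fin m → Carrier) → (Fin m → Carrier) → Carrier
  eval h p q = foldr (λ mon acc → evalMon p q mon + acc) 0# h

  setZero : ∀ {m} → (Fin m → Carrier) → Fin m → Fin m → Carrier
  setZero f i j = if does (i ≟ j) then 0# else f j

  remove : ∀ {k} → (Fin (suc k) → Carrier) → Fin (suc k) → Fin k → Carrier
  remove f i j = f (punchIn i j)

  -- (f₀,…,f_k) ↦ (f₀,…,f_{i-1}, f_i + f_{i+1}, f_{i+2},…,f_k), for i : Fin k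
  mergeAt : ∀ {k} → (Fin (suc k) → Carrier) → Fin k → Fin k → Carrier
  mergeAt f zero    zero    = f zero + f (suc zero)
  mergeAt f zero    (suc j) = f (suc (suc j))
  mergeAt f (suc i) zero    = f zero
  mergeAt f (suc i) (suc j) = mergeAt (λ x → f (suc x)) i j

-- Stable polynomials and the set Sol′.  Polynomial identities are
-- expressed as identities of evaluations in every commutative ring
-- (equivalent to identities in ℤ[p,q], hence in ℂ[p,q]).

StablePoly : Set
StablePoly = (m : ℕ) → Poly m

BoundedDegree : StablePoly → Set
BoundedDegree h = ∃[ d ] ((m : ℕ) → deg (h m) ≤ d)

Stable : StablePoly → Set₁
Stable h = (R : CommutativeRing 0ℓ 0ℓ) → let open CommutativeRing R using (Carrier; _≈_) in
  (m : ℕ) (p q : Fin (suc m) → Carrier) →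
  eval R (h (suc m)) (setZero R p (fromℕ m)) (setZero R q (fromℕ m))
    ≈ eval R (h m) (λ j → p (inject₁ j)) (λ j → q (inject₁ j))

-- condition (Q); m = k+1, position i (0-based) of Fin (k+1)
CondQ : StablePoly → Set₁
CondQ h = (R : CommutativeRing 0ℓ 0ℓ) → let open CommutativeRing R using (Carrier; _≈_) in
  (k : ℕ) (p q : Fin (suc k) → Carrier) →
  -- case i < m (i : Fin k, position inject₁ i)
  ((i : Fin k) →
     eval R (h (suc k)) p (setZero R q (inject₁ i))
       ≈ eval R (h k) (mergeAt R p i) (remove R q (inject₁ i)))
  ×
  -- case i = m
  (eval R (h (suc k)) p (setZero R q (fromℕ k))
     ≈ eval R (h k) (λ j → p (inject₁ j)) (λ j → q (inject₁ j)))

-- condition (P); m = k+1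
CondP : StablePoly → Set₁
CondP h = (R : CommutativeRing 0ℓ 0ℓ) → let open CommutativeRing R using (Carrier; _≈_) in
  (k : ℕ) (p q : Fin (suc k) → Carrier) →
  -- case i > 1: i = j+2 (1-based), position suc j (0-based), j : Fin k
  ((j : Fin k) →
     eval R (h (suc k)) (setZero R p (suc j)) q
       ≈ eval R (h k) (remove R p (suc j)) (mergeAt R q j))
  ×
  -- case i = 1
  (eval R (h (suc k)) (setZero R p zero) q
     ≈ eval R (h k) (λ j → p (suc j)) (λ j → q (suc j)))

Sol′ : StablePoly → Set₁
Sol′ h = BoundedDegree h × Stable h × CondQ h × CondP h

allFuns : (n m : ℕ) → List (Fin n → Fin m)
allFuns zero    m = (λ ()) ∷ []
allFuns (suc n) m =
  concatMap (λ f → map (λ a → λ { zero → a ; (suc x) → f x }) (allFin m)) (allFuns n m)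

allᵇ : {A : Set} → (A → Bool) → List A → Bool
allᵇ P = foldr (λ x b → P x ∧ b) true

-- the order condition for r = (r₁ on V₁, r₂ on V₂); value k : Fin m means rank k+1
orderCond : (G : BipGraph) {m : ℕ} → (Fin (n₁ G) → Fin m) → (Fin (n₂ G) → Fin m) → Bool
orderCond G r₁ r₂ =
  allᵇ (λ v₁ → allᵇ (λ v₂ →
        (if E₁₂ G v₁ v₂ then toℕ (r₁ v₁) ≤ᵇ toℕ (r₂ v₂) else true)
      ∧ (if E₂₁ G v₁ v₂ then toℕ (r₂ v₂) <ᵇ toℕ (r₁ v₁) else true))
    (allFin (n₂ G))) (allFin (n₁ G))

monomialOf : (G : BipGraph) {m : ℕ} → (Fin (n₁ G) → Fin m) → (Fin (n₂ G) → Fin m) → Monomial m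
monomialOf G r₁ r₂ =
  map (λ v₁ → pv (r₁ v₁)) (allFin (n₁ G)) ++ map (λ v₂ → qv (r₂ v₂)) (allFin (n₂ G))

N : BipGraph → StablePoly
N G m =
  concatMap (λ r₁ →
    map (λ r₂ → monomialOf G r₁ r₂)
      (filterᵇ (λ r₂ → orderCond G r₁ r₂) (allFuns (n₂ G) m)))
  (allFuns (n₁ G) m)

-- N_G(p,q) is the sum, over pairs r₁ : V₁ → [m], r₂ : V₂ → [m] satisfying the order
-- condition, of ∏ p(r₁) ∏ q(r₂).  If p and q both vanish at a value z, only pairs avoiding z
-- contribute, and relabelling them along the order embedding punchIn z gives N_G at m - 1;
-- this is stability.  If only q vanishes at the top value (resp. only p at the bottom value),
-- an E₁₂-edge v₁ → v₂ with r₁ v₁ ≤ r₂ v₂ shows that r₁ hitting the top value forces r₂ to hit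
-- it too (resp. r₂ hitting the bottom value forces r₁ to), so again no surviving pair touches
-- that value.  The other cases of (Q) and (P) push forward along pinch i, which merges the
-- values i and i+1 (0-based): the order condition can only change on a pair landing on
-- (i+1, i), where the zeroed variable q_i (resp. p_{i+1}) kills the term, and the sum over
-- each fibre of r ↦ pinch i ∘ r is a product of fibre sums, i.e. of the merged variables.
module Submission where

open import Level using (0ℓ)
open import Function using (_∘_; id; _⇔_; mk⇔; Equivalence)
import Function.Properties.Equivalence as ⇔
open import Data.Bool using (Bool; true; false; _∧_; if_then_else_; T)
open import Data.Bool.Properties using (T-≡; T-∧; ⇔→≡)
open import Data.Empty using (⊥-elim)
open import Data.Nat as ℕ using (ℕ; zero; suc; z≤n; s≤s; _≤ᵇ_; _<ᵇ_)
import Data.Nat.Properties as ℕ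
open import Data.Fin using (Fin; zero; suc; inject₁; fromℕ; punchIn; pinch; _≟_; _≤_)
open import Data.Fin.Properties
  using (punchInᵢ≢i; punchIn-mono-≤; punchIn-cancel-≤; pinch-mono-≤; ≤fromℕ; ¬∀⟶∃¬; all?; any?)
import Data.Fin.Properties as Fin
open import Data.List using (List; []; _∷_; map; concatMap; filterᵇ; allFin; length; _++_)
open import Data.List.Properties using (map-tabulate; length-++; length-map; length-tabulate)
open import Data.List.Relation.Unary.All using (All; []; _∷_; universal)
open import Data.List.Relation.Unary.All.Properties using (concat⁺; map⁺)
open import Data.List.Relation.Unary.Any using (here; there)
open import Data.List.Membership.Propositional using (_∈_)
open import Data.List.Membership.Propositional.Properties using (∈-allFin)
open import Data.Product as Product using (_×_; _,_; proj₁; proj₂)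
open import Data.Sum as Sum using (_⊎_; inj₁; inj₂)
import Data.Vec.Functional as Vector
open import Relation.Nullary using (¬_; does; yes; no)
open import Relation.Nullary.Decidable using (dec-true; dec-false)
open import Relation.Binary.PropositionalEquality using (_≡_; _≢_; _≗_; cong; cong₂; subst)
import Relation.Binary.PropositionalEquality as ≡
open import Algebra.Bundles using (CommutativeMonoid; CommutativeSemiring; CommutativeRing)

open import Defs

private variable
  A B : Set
  n m k : ℕ

-- Finite sums and products over lists

module Fold {c ℓ} (M : CommutativeMonoid c ℓ) where
  open CommutativeMonoid M
  open import Algebra.Properties.CommutativeSemigroup commutativeSemigroup using (interchange; x∙yz≈y∙xz)
  open import Relation.Binary.Reasoning.Setoid setoid

  fold : List A → (A → Carrier) → Carrier
  fold []       f = ε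
  fold (x ∷ xs) f = f x ∙ fold xs f

  private variable
    f g : A → Carrier

  fold-cong : ∀ xs → (∀ x → f x ≈ g x) → fold xs f ≈ fold xs g
  fold-cong []       f≈g = refl
  fold-cong (x ∷ xs) f≈g = ∙-cong (f≈g x) (fold-cong xs f≈g)

  fold-++ : ∀ xs ys → fold (xs ++ ys) f ≈ fold xs f ∙ fold ys f
  fold-++ []       ys = sym (identityˡ _)
  fold-++ (x ∷ xs) ys = trans (∙-congˡ (fold-++ xs ys)) (sym (assoc _ _ _))

  fold-map : ∀ (h : A → B) xs → fold (map h xs) f ≡ fold xs (f ∘ h)
  fold-map h []       = ≡.refl
  fold-map h (x ∷ xs) = cong (_ ∙_) (fold-map h xs)

  fold-concatMap : ∀ (h : A → List B) xs → fold (concatMap h xs) f ≈ fold xs (λ x → fold (h x) f)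
  fold-concatMap h []       = refl
  fold-concatMap h (x ∷ xs) = trans (fold-++ (h x) _) (∙-congˡ (fold-concatMap h xs))

  fold-ε : ∀ xs → (∀ x → f x ≈ ε) → fold xs f ≈ ε
  fold-ε []       f≈ε = refl
  fold-ε (x ∷ xs) f≈ε = trans (∙-cong (f≈ε x) (fold-ε xs f≈ε)) (identityˡ ε)

  fold-∙ : ∀ xs → fold xs (λ x → f x ∙ g x) ≈ fold xs f ∙ fold xs g
  fold-∙ []       = sym (identityˡ ε)
  fold-∙ (x ∷ xs) = trans (∙-congˡ (fold-∙ xs)) (interchange _ _ _ _)

  fold-swap : ∀ xs (ys : List B) (h : A → B → Carrier) →
    fold xs (λ x → fold ys (h x)) ≈ fold ys (λ y → fold xs (λ x → h x y))
  fold-swap []       ys h = sym (fold-ε ys (λ _ → refl))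
  fold-swap (x ∷ xs) ys h = trans (∙-congˡ (fold-swap xs ys h)) (sym (fold-∙ ys))

  fold-allFin-suc : ∀ (f : Fin (suc n) → Carrier) → fold (allFin (suc n)) f ≡ f zero ∙ fold (allFin n) (f ∘ suc)
  fold-allFin-suc {n} f = cong (f zero ∙_)
    (≡.trans (cong (λ xs → fold xs f) (≡.sym (map-tabulate id suc))) (fold-map suc (allFin n)))

  fold-punchIn : ∀ (z : Fin (suc n)) (f : Fin (suc n) → Carrier) →
    fold (allFin (suc n)) f ≈ f z ∙ fold (allFin n) (f ∘ punchIn z)
  fold-punchIn zero f = reflexive (fold-allFin-suc f)
  fold-punchIn {suc n} (suc z) f = begin
    fold (allFin (suc (suc n))) f                                 ≡⟨ fold-allFin-suc f ⟩
    f zero ∙ fold (allFin (suc n)) (f ∘ suc)                     ≈⟨ ∙-congˡ (fold-punchIn z (f ∘ suc)) ⟩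
    f zero ∙ (f (suc z) ∙ fold (allFin n) (f ∘ suc ∘ punchIn z))  ≈⟨ x∙yz≈y∙xz _ _ _ ⟩
    f (suc z) ∙ (f zero ∙ fold (allFin n) (f ∘ suc ∘ punchIn z))
      ≡⟨ cong (f (suc z) ∙_) (≡.sym (fold-allFin-suc (f ∘ punchIn (suc z)))) ⟩
    f (suc z) ∙ fold (allFin (suc n)) (f ∘ punchIn (suc z))       ∎

module Sums {c ℓ} (S : CommutativeSemiring c ℓ) where
  open CommutativeSemiring S hiding (zero)
  open import Algebra.Properties.CommutativeSemigroup *-commutativeSemigroup using (x∙yz≈y∙xz)
  open import Relation.Binary.Reasoning.Setoid setoid
  private
    module ΣM = Fold +-commutativeMonoid
    module ΠM = Fold *-commutativeMonoid

  ∑ : List A → (A → Carrier) → Carrier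
  ∑ = ΣM.fold
  syntax ∑ xs (λ x → e) = ∑[ x ∈ xs ] e

  ∏ : List A → (A → Carrier) → Carrier
  ∏ = ΠM.fold
  syntax ∏ xs (λ x → e) = ∏[ x ∈ xs ] e

  open ΣM public using () renaming
    ( fold-cong to ∑-cong; fold-map to ∑-map; fold-concatMap to ∑-concatMap; fold-ε to ∑-0
    ; fold-swap to ∑-swap; fold-allFin-suc to ∑-allFin-suc; fold-punchIn to ∑-punchIn)
  open ΠM public using () renaming
    ( fold-cong to ∏-cong; fold-++ to ∏-++; fold-map to ∏-map; fold-ε to ∏-1; fold-∙ to ∏-*
    ; fold-allFin-suc to ∏-allFin-suc)

  private variable
    xs : List A
    f : A → Carrier
    g : B → Carrier

  ∑-*ˡ : ∀ xs x → ∑[ a ∈ xs ] (x * f a) ≈ x * ∑ xs f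
  ∑-*ˡ []       x = sym (zeroʳ x)
  ∑-*ˡ (a ∷ xs) x = trans (+-congˡ (∑-*ˡ xs x)) (sym (distribˡ x _ _))

  ∑-*ʳ : ∀ xs x → ∑[ a ∈ xs ] (f a * x) ≈ ∑ xs f * x
  ∑-*ʳ []       x = sym (zeroˡ x)
  ∑-*ʳ (a ∷ xs) x = trans (+-congˡ (∑-*ʳ xs x)) (sym (distribʳ x _ _))

  ∑∑-* : ∀ xs (ys : List B) → ∑[ a ∈ xs ] ∑[ b ∈ ys ] (f a * g b) ≈ ∑ xs f * ∑ ys g
  ∑∑-* xs ys = trans (∑-cong xs (λ a → ∑-*ˡ ys _)) (∑-*ʳ xs _)

  ∏-zero : ∀ {x} → x ∈ xs → f x ≈ 0# → ∏ xs f ≈ 0#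
  ∏-zero (here ≡.refl) fx≈0 = trans (*-congʳ fx≈0) (zeroˡ _)
  ∏-zero (there x∈xs)  fx≈0 = trans (*-congˡ (∏-zero x∈xs fx≈0)) (zeroʳ _)

  when : Bool → Carrier → Carrier
  when b x = if b then x else 0#

  when-cong : ∀ b {x y} → x ≈ y → when b x ≈ when b y
  when-cong true  x≈y = x≈y
  when-cong false x≈y = refl

  when-0 : ∀ b {x} → x ≈ 0# → when b x ≈ 0#
  when-0 true  x≈0 = x≈0
  when-0 false x≈0 = refl

  ∑-when : ∀ b xs → ∑[ a ∈ xs ] when b (f a) ≈ when b (∑ xs f)
  ∑-when true  xs = refl
  ∑-when false xs = ∑-0 xs (λ _ → refl)

  ∑-filterᵇ : ∀ (P : A → Bool) xs → ∑ (filterᵇ P xs) f ≈ ∑[ a ∈ xs ] when (P a) (f a)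
  ∑-filterᵇ P []       = refl
  ∑-filterᵇ P (a ∷ xs) with P a
  ... | true  = +-congˡ (∑-filterᵇ P xs)
  ... | false = trans (∑-filterᵇ P xs) (sym (+-identityˡ _))

  *-when-interchange : ∀ b x y u w → x * (y * when b (u * w)) ≈ when b ((x * u) * (y * w))
  *-when-interchange true  x y u w = trans (*-congˡ (x∙yz≈y∙xz y u w)) (sym (*-assoc x u (y * w)))
  *-when-interchange false x y u w = trans (*-congˡ (zeroʳ y)) (zeroʳ x)

  -- Sums over functions between finite sets

  δ : Fin n → Fin n → Carrier
  δ a b = if does (a ≟ b) then 1# else 0#

  δ-comm : ∀ (a b : Fin n) → δ a b ≡ δ b a
  δ-comm zero    zero    = ≡.refl
  δ-comm zero    (suc b) = ≡.refl
  δ-comm (suc a) zero    = ≡.refl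
  δ-comm (suc a) (suc b) = δ-comm a b

  δ-≢ : ∀ {a b : Fin n} → a ≢ b → δ a b ≡ 0#
  δ-≢ {a = a} {b} a≢b = cong (if_then 1# else 0#) (dec-false (a ≟ b) a≢b)

  ∑-δˡ : ∀ (b : Fin n) (f : Fin n → Carrier) → ∑[ a ∈ allFin n ] (δ a b * f a) ≈ f b
  ∑-δˡ {suc n} zero    f = begin
    ∑[ a ∈ allFin (suc n) ] (δ a zero * f a)          ≡⟨ ∑-allFin-suc (λ a → δ a zero * f a) ⟩
    1# * f zero + ∑[ a ∈ allFin n ] (0# * f (suc a))  ≈⟨ +-cong (*-identityˡ _) (∑-0 (allFin n) (λ a → zeroˡ _)) ⟩
    f zero + 0#                                       ≈⟨ +-identityʳ _ ⟩
    f zero                                            ∎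
  ∑-δˡ {suc n} (suc b) f = begin
    ∑[ a ∈ allFin (suc n) ] (δ a (suc b) * f a)          ≡⟨ ∑-allFin-suc (λ a → δ a (suc b) * f a) ⟩
    0# * f zero + ∑[ a ∈ allFin n ] (δ a b * f (suc a))  ≈⟨ +-cong (zeroˡ _) (∑-δˡ b (f ∘ suc)) ⟩
    0# + f (suc b)                                       ≈⟨ +-identityˡ _ ⟩
    f (suc b)                                            ∎

  ∑-δʳ : ∀ (a : Fin n) → ∑[ b ∈ allFin n ] δ a b ≈ 1#
  ∑-δʳ a = trans (∑-cong (allFin _) (λ b → trans (reflexive (δ-comm a b)) (sym (*-identityʳ _))))
                 (∑-δˡ a (λ _ → 1#))

  Extensional : ((Fin n → Fin m) → Carrier) → Set _
  Extensional F = ∀ {r s} → r ≗ s → F r ≈ F s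

  -- allFuns builds its functions by pattern-matching lambdas, which are only pointwise equal
  -- to a Vector.∷ r; hence the extensionality hypotheses below.
  ∑-allFuns-suc : ∀ (F : (Fin (suc n) → Fin m) → Carrier) → Extensional F →
    ∑[ r ∈ allFuns (suc n) m ] F r ≈ ∑[ r ∈ allFuns n m ] ∑[ a ∈ allFin m ] F (a Vector.∷ r)
  ∑-allFuns-suc {n} {m} F ext = trans (∑-concatMap _ (allFuns n m)) (∑-cong (allFuns n m) (λ r →
    trans (reflexive (∑-map _ (allFin m)))
          (∑-cong (allFin m) (λ a → ext (λ { zero → ≡.refl ; (suc v) → ≡.refl })))))

  ∑-allFuns-∏ : ∀ n (h : Fin n → Fin m → Carrier) →
    ∑[ r ∈ allFuns n m ] ∏[ v ∈ allFin n ] h v (r v) ≈ ∏[ v ∈ allFin n ] ∑[ a ∈ allFin m ] h v a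
  ∑-allFuns-∏ zero    h = +-identityʳ 1#
  ∑-allFuns-∏ {m} (suc n) h = begin
    ∑[ r ∈ allFuns (suc n) m ] ∏[ v ∈ allFin (suc n) ] h v (r v)
      ≈⟨ ∑-allFuns-suc _ (λ r≗s → ∏-cong (allFin (suc n)) (λ v → reflexive (cong (h v) (r≗s v)))) ⟩
    ∑[ r ∈ allFuns n m ] ∑[ a ∈ allFin m ] ∏[ v ∈ allFin (suc n) ] h v ((a Vector.∷ r) v)
      ≈⟨ ∑-cong (allFuns n m) (λ r → ∑-cong (allFin m) (λ a →
           reflexive (∏-allFin-suc (λ v → h v ((a Vector.∷ r) v))))) ⟩
    ∑[ r ∈ allFuns n m ] ∑[ a ∈ allFin m ] (h zero a * ∏[ v ∈ allFin n ] h (suc v) (r v))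
      ≈⟨ trans (∑-swap (allFuns n m) (allFin m) _) (∑∑-* (allFin m) (allFuns n m)) ⟩
    ∑[ a ∈ allFin m ] h zero a * ∑[ r ∈ allFuns n m ] ∏[ v ∈ allFin n ] h (suc v) (r v)
      ≈⟨ *-congˡ (∑-allFuns-∏ n (h ∘ suc)) ⟩
    ∑[ a ∈ allFin m ] h zero a * ∏[ v ∈ allFin n ] ∑[ a ∈ allFin m ] h (suc v) a
      ≡⟨ ≡.sym (∏-allFin-suc (λ v → ∑[ a ∈ allFin m ] h v a)) ⟩
    ∏[ v ∈ allFin (suc n) ] ∑[ a ∈ allFin m ] h v a ∎

  ∑-allFuns-punchIn : ∀ n (z : Fin (suc k)) (F : (Fin n → Fin (suc k)) → Carrier) → Extensional F →
    (∀ r v → r v ≡ z → F r ≈ 0#) →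
    ∑[ r ∈ allFuns n (suc k) ] F r ≈ ∑[ r ∈ allFuns n k ] F (punchIn z ∘ r)
  ∑-allFuns-punchIn zero    z F ext vanish = +-congʳ (ext (λ ()))
  ∑-allFuns-punchIn {k} (suc n) z F ext vanish = begin
    ∑[ r ∈ allFuns (suc n) (suc k) ] F r
      ≈⟨ ∑-allFuns-suc F ext ⟩
    ∑[ r ∈ allFuns n (suc k) ] ∑[ a ∈ allFin (suc k) ] F (a Vector.∷ r)
      ≈⟨ ∑-cong (allFuns n (suc k)) (λ r → ∑-punchIn z (λ a → F (a Vector.∷ r))) ⟩
    ∑[ r ∈ allFuns n (suc k) ] (F (z Vector.∷ r) + ∑[ b ∈ allFin k ] F (punchIn z b Vector.∷ r))
      ≈⟨ ∑-cong (allFuns n (suc k)) (λ r → trans (+-congʳ (vanish _ zero ≡.refl)) (+-identityˡ _)) ⟩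
    ∑[ r ∈ allFuns n (suc k) ] ∑[ b ∈ allFin k ] F (punchIn z b Vector.∷ r)
      ≈⟨ ∑-allFuns-punchIn n z _
           (λ r≗s → ∑-cong (allFin k) (λ b → ext (λ { zero → ≡.refl ; (suc v) → r≗s v })))
           (λ r v rv≡z → ∑-0 (allFin k) (λ b → vanish _ (suc v) rv≡z)) ⟩
    ∑[ r ∈ allFuns n k ] ∑[ b ∈ allFin k ] F (punchIn z b Vector.∷ (punchIn z ∘ r))
      ≈⟨ ∑-cong (allFuns n k) (λ r → ∑-cong (allFin k) (λ b →
           ext (λ { zero → ≡.refl ; (suc v) → ≡.refl }))) ⟩
    ∑[ r ∈ allFuns n k ] ∑[ b ∈ allFin k ] F (punchIn z ∘ (b Vector.∷ r))
      ≈⟨ sym (∑-allFuns-suc (F ∘ (punchIn z ∘_)) (λ r≗s → ext (cong (punchIn z) ∘ r≗s))) ⟩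
    ∑[ r ∈ allFuns (suc n) k ] F (punchIn z ∘ r) ∎

  δᶠ : (Fin n → Fin m) → (Fin n → Fin m) → Carrier
  δᶠ {n} r s = ∏[ v ∈ allFin n ] δ (r v) (s v)

  ∑-δᶠ : ∀ (r : Fin n → Fin m) → ∑[ s ∈ allFuns n m ] δᶠ r s ≈ 1#
  ∑-δᶠ {n} r = trans (∑-allFuns-∏ n (λ v → δ (r v))) (∏-1 (allFin n) (λ v → ∑-δʳ (r v)))

  δᶠ-guard : ∀ (r s : Fin n → Fin m) {x y} → (r ≗ s → x ≈ y) → δᶠ r s * x ≈ δᶠ r s * y
  δᶠ-guard {n} r s {x} {y} x≈y with all? (λ v → r v ≟ s v)
  ... | yes r≗s = *-congˡ (x≈y r≗s)
  ... | no  r≉s = trans (*-congʳ δᶠ≈0) (trans (zeroˡ x) (sym (trans (*-congʳ δᶠ≈0) (zeroˡ y))))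
    where
    δᶠ≈0 : δᶠ r s ≈ 0#
    δᶠ≈0 = let v , rv≢sv = ¬∀⟶∃¬ n _ (λ v → r v ≟ s v) r≉s in
      ∏-zero (∈-allFin v) (reflexive (δ-≢ rv≢sv))

  push : (Fin m → Fin k) → (Fin m → Carrier) → Fin k → Carrier
  push {m} κ f b = ∑[ a ∈ allFin m ] (δ (κ a) b * f a)

  -- Insert 1 = ∑ₛ δᶠ (κ ∘ r) s into every summand.
  ∑-fibres : ∀ (κ : Fin m → Fin k) (F : (Fin n → Fin m) → Carrier) →
    ∑[ r ∈ allFuns n m ] F r ≈ ∑[ s ∈ allFuns n k ] ∑[ r ∈ allFuns n m ] (δᶠ (κ ∘ r) s * F r)
  ∑-fibres {m} {k} {n} κ F = begin
    ∑[ r ∈ allFuns n m ] F r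
      ≈⟨ ∑-cong (allFuns n m) (λ r → sym (trans (*-congʳ (∑-δᶠ (κ ∘ r))) (*-identityˡ (F r)))) ⟩
    ∑[ r ∈ allFuns n m ] (∑[ s ∈ allFuns n k ] δᶠ (κ ∘ r) s * F r)
      ≈⟨ ∑-cong (allFuns n m) (λ r → sym (∑-*ʳ (allFuns n k) (F r))) ⟩
    ∑[ r ∈ allFuns n m ] ∑[ s ∈ allFuns n k ] (δᶠ (κ ∘ r) s * F r)
      ≈⟨ ∑-swap (allFuns n m) (allFuns n k) _ ⟩
    ∑[ s ∈ allFuns n k ] ∑[ r ∈ allFuns n m ] (δᶠ (κ ∘ r) s * F r) ∎

  ∑∑-fibres : ∀ {n₁ n₂} (κ : Fin m → Fin k) (F : (Fin n₁ → Fin m) → (Fin n₂ → Fin m) → Carrier) →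
    ∑[ r₁ ∈ allFuns n₁ m ] ∑[ r₂ ∈ allFuns n₂ m ] F r₁ r₂ ≈
    ∑[ s₁ ∈ allFuns n₁ k ] ∑[ s₂ ∈ allFuns n₂ k ] ∑[ r₁ ∈ allFuns n₁ m ] ∑[ r₂ ∈ allFuns n₂ m ]
      (δᶠ (κ ∘ r₁) s₁ * (δᶠ (κ ∘ r₂) s₂ * F r₁ r₂))
  ∑∑-fibres {m} {k} {n₁} {n₂} κ F = begin
    ∑[ r₁ ∈ allFuns n₁ m ] ∑[ r₂ ∈ allFuns n₂ m ] F r₁ r₂
      ≈⟨ ∑-fibres κ (λ r₁ → ∑[ r₂ ∈ allFuns n₂ m ] F r₁ r₂) ⟩
    ∑[ s₁ ∈ allFuns n₁ k ] ∑[ r₁ ∈ allFuns n₁ m ] (δᶠ (κ ∘ r₁) s₁ * ∑[ r₂ ∈ allFuns n₂ m ] F r₁ r₂)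
      ≈⟨ ∑-cong (allFuns n₁ k) (λ s₁ → ∑-cong (allFuns n₁ m) (λ r₁ → *-congˡ (∑-fibres κ (F r₁)))) ⟩
    ∑[ s₁ ∈ allFuns n₁ k ] ∑[ r₁ ∈ allFuns n₁ m ]
      (δᶠ (κ ∘ r₁) s₁ * ∑[ s₂ ∈ allFuns n₂ k ] ∑[ r₂ ∈ allFuns n₂ m ] (δᶠ (κ ∘ r₂) s₂ * F r₁ r₂))
      ≈⟨ ∑-cong (allFuns n₁ k) (λ s₁ → ∑-cong (allFuns n₁ m) (λ r₁ → sym
           (trans (∑-cong (allFuns n₂ k) (λ s₂ → ∑-*ˡ (allFuns n₂ m) _)) (∑-*ˡ (allFuns n₂ k) _)))) ⟩
    ∑[ s₁ ∈ allFuns n₁ k ] ∑[ r₁ ∈ allFuns n₁ m ] ∑[ s₂ ∈ allFuns n₂ k ] ∑[ r₂ ∈ allFuns n₂ m ]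
      (δᶠ (κ ∘ r₁) s₁ * (δᶠ (κ ∘ r₂) s₂ * F r₁ r₂))
      ≈⟨ ∑-cong (allFuns n₁ k) (λ s₁ → ∑-swap (allFuns n₁ m) (allFuns n₂ k) _) ⟩
    ∑[ s₁ ∈ allFuns n₁ k ] ∑[ s₂ ∈ allFuns n₂ k ] ∑[ r₁ ∈ allFuns n₁ m ] ∑[ r₂ ∈ allFuns n₂ m ]
      (δᶠ (κ ∘ r₁) s₁ * (δᶠ (κ ∘ r₂) s₂ * F r₁ r₂)) ∎

  ∑-fibre-∏ : ∀ (κ : Fin m → Fin k) (f : Fin m → Carrier) (s : Fin n → Fin k) →
    ∑[ r ∈ allFuns n m ] (δᶠ (κ ∘ r) s * ∏[ v ∈ allFin n ] f (r v)) ≈ ∏[ v ∈ allFin n ] push κ f (s v)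
  ∑-fibre-∏ {m} {n = n} κ f s =
    trans (∑-cong (allFuns n m) (λ r → sym (∏-* (allFin n))))
          (∑-allFuns-∏ n (λ v a → δ (κ a) (s v) * f a))

-- The order condition

pinch-cancel-≤ : ∀ (i : Fin k) {x y : Fin (suc k)} →
  pinch i x ≤ pinch i y → x ≤ y ⊎ (x ≡ suc i × y ≡ inject₁ i)
pinch-cancel-≤ i       {zero}                _         = inj₁ z≤n
pinch-cancel-≤ zero    {suc zero}    {zero}  _         = inj₂ (≡.refl , ≡.refl)
pinch-cancel-≤ zero    {suc (suc x)} {zero}  ()
pinch-cancel-≤ zero    {suc x}       {suc y} x≤y       = inj₁ (s≤s x≤y)
pinch-cancel-≤ (suc i) {suc x}       {zero}  ()
pinch-cancel-≤ (suc i) {suc x}       {suc y} (s≤s x≤y) =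
  Sum.map s≤s (Product.map (cong suc) (cong suc)) (pinch-cancel-≤ i x≤y)

punchIn-fromℕ : ∀ (j : Fin k) → punchIn (fromℕ k) j ≡ inject₁ j
punchIn-fromℕ zero    = ≡.refl
punchIn-fromℕ (suc j) = cong suc (punchIn-fromℕ j)

T-injective : ∀ {a b} → T a ⇔ T b → a ≡ b
T-injective a⇔b = ⇔→≡ {z = true} (mk⇔ (to T-≡ ∘ to a⇔b ∘ from T-≡) (to T-≡ ∘ from a⇔b ∘ from T-≡))
  where open Equivalence

≤ᵇ-cong : ∀ {x y x′ y′} → x ℕ.≤ y ⇔ x′ ℕ.≤ y′ → (x ≤ᵇ y) ≡ (x′ ≤ᵇ y′)
≤ᵇ-cong h = T-injective (mk⇔ (ℕ.≤⇒≤ᵇ ∘ to h ∘ ℕ.≤ᵇ⇒≤ _ _) (ℕ.≤⇒≤ᵇ ∘ from h ∘ ℕ.≤ᵇ⇒≤ _ _))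
  where open Equivalence

<ᵇ-cong : ∀ {x y x′ y′} → x ℕ.≤ y ⇔ x′ ℕ.≤ y′ → (y <ᵇ x) ≡ (y′ <ᵇ x′)
<ᵇ-cong h = T-injective (mk⇔ (ℕ.<⇒<ᵇ ∘ ℕ.≰⇒> ∘ (λ y<x → ℕ.<⇒≱ y<x ∘ from h) ∘ ℕ.<ᵇ⇒< _ _)
                             (ℕ.<⇒<ᵇ ∘ ℕ.≰⇒> ∘ (λ y<x → ℕ.<⇒≱ y<x ∘ to h) ∘ ℕ.<ᵇ⇒< _ _))
  where open Equivalence

allᵇ-cong : ∀ {P Q : A → Bool} xs → (∀ x → P x ≡ Q x) → allᵇ P xs ≡ allᵇ Q xs
allᵇ-cong []       P≡Q = ≡.refl
allᵇ-cong (x ∷ xs) P≡Q = cong₂ _∧_ (P≡Q x) (allᵇ-cong xs P≡Q)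

allᵇ-∈ : ∀ {P : A → Bool} {xs x} → T (allᵇ P xs) → x ∈ xs → T (P x)
allᵇ-∈ all (here ≡.refl) = proj₁ (Equivalence.to T-∧ all)
allᵇ-∈ all (there x∈xs) = allᵇ-∈ (proj₂ (Equivalence.to T-∧ all)) x∈xs

module _ (G : BipGraph) where

  orderCond-cong : ∀ (r₁ : Fin (n₁ G) → Fin m) r₂ (s₁ : Fin (n₁ G) → Fin k) s₂ →
    (∀ v₁ v₂ → r₁ v₁ ≤ r₂ v₂ ⇔ s₁ v₁ ≤ s₂ v₂) → orderCond G r₁ r₂ ≡ orderCond G s₁ s₂
  orderCond-cong r₁ r₂ s₁ s₂ same = allᵇ-cong (allFin (n₁ G)) (λ v₁ → allᵇ-cong (allFin (n₂ G)) (λ v₂ →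
    cong₂ _∧_ (cong (if E₁₂ G v₁ v₂ then_else true) (≤ᵇ-cong (same v₁ v₂)))
              (cong (if E₂₁ G v₁ v₂ then_else true) (<ᵇ-cong (same v₁ v₂)))))

  orderCond-cong-≗ : ∀ {r₁ s₁ : Fin (n₁ G) → Fin m} {r₂ s₂} → r₁ ≗ s₁ → r₂ ≗ s₂ →
    orderCond G r₁ r₂ ≡ orderCond G s₁ s₂
  orderCond-cong-≗ {r₁ = r₁} {s₁} {r₂} {s₂} r₁≗s₁ r₂≗s₂ = orderCond-cong r₁ r₂ s₁ s₂ (λ v₁ v₂ →
    ≡.subst₂ (λ x y → r₁ v₁ ≤ r₂ v₂ ⇔ x ≤ y) (r₁≗s₁ v₁) (r₂≗s₂ v₂) ⇔.refl)

  orderCond-pinch : ∀ (i : Fin k) {r₁ : Fin (n₁ G) → Fin (suc k)} {r₂} →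
    (∀ v₁ v₂ → ¬ (r₁ v₁ ≡ suc i × r₂ v₂ ≡ inject₁ i)) →
    orderCond G r₁ r₂ ≡ orderCond G (pinch i ∘ r₁) (pinch i ∘ r₂)
  orderCond-pinch i {r₁} {r₂} unmerged = orderCond-cong r₁ r₂ (pinch i ∘ r₁) (pinch i ∘ r₂) (λ v₁ v₂ →
    mk⇔ (pinch-mono-≤ i) (Sum.[ id , ⊥-elim ∘ unmerged v₁ v₂ ] ∘ pinch-cancel-≤ i))

  orderCond-E₁₂ : ∀ {r₁ : Fin (n₁ G) → Fin m} {r₂ v₁ v₂} → E₁₂ G v₁ v₂ ≡ true →
    T (orderCond G r₁ r₂) → r₁ v₁ ≤ r₂ v₂
  orderCond-E₁₂ {v₁ = v₁} {v₂} e oc = ℕ.≤ᵇ⇒≤ _ _ (subst (λ b → T (if b then _ else true)) e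
    (proj₁ (Equivalence.to T-∧ (allᵇ-∈ (allᵇ-∈ oc (∈-allFin v₁)) (∈-allFin v₂)))))

-- Evaluating N_G

module _ (R : CommutativeRing 0ℓ 0ℓ) where
  open CommutativeRing R hiding (zero)
  open Sums commutativeSemiring
  open import Relation.Binary.Reasoning.Setoid setoid

  setZero-≡ : ∀ (f : Fin m → Carrier) {z a} → a ≡ z → setZero R f z a ≡ 0#
  setZero-≡ f {z} ≡.refl = cong (if_then 0# else f z) (dec-true (z ≟ z) ≡.refl)

  setZero-punchIn : ∀ (f : Fin (suc m) → Carrier) z j → setZero R f z (punchIn z j) ≡ f (punchIn z j)
  setZero-punchIn f z j =
    cong (if_then 0# else f (punchIn z j)) (dec-false (z ≟ punchIn z j) (punchInᵢ≢i z j ∘ ≡.sym))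

  setZero-last : ∀ (f : Fin (suc m) → Carrier) j → setZero R f (fromℕ m) (punchIn (fromℕ m) j) ≡ f (inject₁ j)
  setZero-last f j = ≡.trans (setZero-punchIn f _ j) (cong f (punchIn-fromℕ j))

  mergeAt-push : ∀ (f : Fin (suc k) → Carrier) i b → mergeAt R f i b ≈ push (pinch i) f b
  mergeAt-push f i b = trans (mergeAt-unfolded f i b)
    (reflexive (≡.sym (∑-allFin-suc (λ a → δ (pinch i a) b * f a))))
    where
    mergeAt-unfolded : ∀ (f : Fin (suc k) → Carrier) i b →
      mergeAt R f i b ≈ δ (pinch i zero) b * f zero + push (pinch i ∘ suc) (f ∘ suc) b
    mergeAt-unfolded f zero zero =
      +-cong (sym (*-identityˡ _)) (sym (∑-δˡ zero (f ∘ suc)))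
    mergeAt-unfolded f zero (suc b) =
      trans (sym (+-identityˡ _)) (+-cong (sym (zeroˡ _)) (sym (∑-δˡ (suc b) (f ∘ suc))))
    mergeAt-unfolded {suc k} f (suc i) zero =
      trans (sym (+-identityʳ _)) (+-cong (sym (*-identityˡ _)) (sym (∑-0 (allFin (suc k)) (λ _ → zeroˡ _))))
    mergeAt-unfolded f (suc i) (suc b) =
      trans (mergeAt-push (f ∘ suc) i b) (trans (sym (+-identityˡ _)) (+-congʳ (sym (zeroˡ _))))

  mergeAt-setZero-inject₁ : ∀ (f : Fin (suc k) → Carrier) i b →
    mergeAt R (setZero R f (inject₁ i)) i b ≈ f (punchIn (inject₁ i) b)
  mergeAt-setZero-inject₁ f zero    zero    = +-identityˡ _
  mergeAt-setZero-inject₁ f zero    (suc b) = refl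
  mergeAt-setZero-inject₁ f (suc i) zero    = refl
  mergeAt-setZero-inject₁ f (suc i) (suc b) = mergeAt-setZero-inject₁ (f ∘ suc) i b

  mergeAt-setZero-suc : ∀ (f : Fin (suc k) → Carrier) i b →
    mergeAt R (setZero R f (suc i)) i b ≈ f (punchIn (suc i) b)
  mergeAt-setZero-suc f zero    zero    = +-identityʳ _
  mergeAt-setZero-suc f zero    (suc b) = refl
  mergeAt-setZero-suc f (suc i) zero    = refl
  mergeAt-setZero-suc f (suc i) (suc b) = mergeAt-setZero-suc (f ∘ suc) i b

  module _ (G : BipGraph) where
    private
      V₁ = Fin (n₁ G)
      V₂ = Fin (n₂ G)

      ranks₁ : ∀ m → List (V₁ → Fin m)
      ranks₁ = allFuns (n₁ G)

      ranks₂ : ∀ m → List (V₂ → Fin m)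
      ranks₂ = allFuns (n₂ G)

    weight : (p q : Fin m → Carrier) → (V₁ → Fin m) → (V₂ → Fin m) → Carrier
    weight p q r₁ r₂ = ∏[ v ∈ allFin (n₁ G) ] p (r₁ v) * ∏[ v ∈ allFin (n₂ G) ] q (r₂ v)

    summand : (p q : Fin m → Carrier) → (V₁ → Fin m) → (V₂ → Fin m) → Carrier
    summand p q r₁ r₂ = when (orderCond G r₁ r₂) (weight p q r₁ r₂)

    eval≡∑ : ∀ (h : Poly m) p q → eval R h p q ≡ ∑ h (evalMon R p q)
    eval≡∑ []        p q = ≡.refl
    eval≡∑ (mon ∷ h) p q = cong (evalMon R p q mon +_) (eval≡∑ h p q)

    evalMon≡∏ : ∀ (mon : Monomial m) p q → evalMon R p q mon ≡ ∏ mon (evalVar R p q)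
    evalMon≡∏ []        p q = ≡.refl
    evalMon≡∏ (x ∷ mon) p q = cong (evalVar R p q x *_) (evalMon≡∏ mon p q)

    evalMon-monomialOf : ∀ (p q : Fin m → Carrier) r₁ r₂ → evalMon R p q (monomialOf G r₁ r₂) ≈ weight p q r₁ r₂
    evalMon-monomialOf p q r₁ r₂ = begin
      evalMon R p q (monomialOf G r₁ r₂)
        ≡⟨ evalMon≡∏ (monomialOf G r₁ r₂) p q ⟩
      ∏ (map (pv ∘ r₁) (allFin (n₁ G)) ++ map (qv ∘ r₂) (allFin (n₂ G))) (evalVar R p q)
        ≈⟨ ∏-++ (map (pv ∘ r₁) (allFin (n₁ G))) _ ⟩
      ∏ (map (pv ∘ r₁) (allFin (n₁ G))) (evalVar R p q) * ∏ (map (qv ∘ r₂) (allFin (n₂ G))) (evalVar R p q)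
        ≡⟨ cong₂ _*_ (∏-map (pv ∘ r₁) (allFin (n₁ G))) (∏-map (qv ∘ r₂) (allFin (n₂ G))) ⟩
      weight p q r₁ r₂ ∎

    eval-N : ∀ (p q : Fin m → Carrier) →
      eval R (N G m) p q ≈ ∑[ r₁ ∈ ranks₁ m ] ∑[ r₂ ∈ ranks₂ m ] summand p q r₁ r₂
    eval-N {m} p q = begin
      eval R (N G m) p q
        ≡⟨ eval≡∑ (N G m) p q ⟩
      ∑ (N G m) (evalMon R p q)
        ≈⟨ ∑-concatMap _ (ranks₁ m) ⟩
      ∑[ r₁ ∈ ranks₁ m ] ∑ (map (monomialOf G r₁) (filterᵇ (orderCond G r₁) (ranks₂ m))) (evalMon R p q)
        ≈⟨ ∑-cong (ranks₁ m) (λ r₁ → trans (reflexive (∑-map (monomialOf G r₁) (filterᵇ (orderCond G r₁) (ranks₂ m))))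
                                            (∑-filterᵇ (orderCond G r₁) (ranks₂ m))) ⟩
      ∑[ r₁ ∈ ranks₁ m ] ∑[ r₂ ∈ ranks₂ m ] when (orderCond G r₁ r₂) (evalMon R p q (monomialOf G r₁ r₂))
        ≈⟨ ∑-cong (ranks₁ m) (λ r₁ → ∑-cong (ranks₂ m) (λ r₂ →
             when-cong (orderCond G r₁ r₂) (evalMon-monomialOf p q r₁ r₂))) ⟩
      ∑[ r₁ ∈ ranks₁ m ] ∑[ r₂ ∈ ranks₂ m ] summand p q r₁ r₂ ∎

    weight-cong : ∀ {p q p′ q′ : Fin m → Carrier} {r₁ s₁ r₂ s₂} → (∀ a → p a ≈ p′ a) → (∀ a → q a ≈ q′ a) →
      r₁ ≗ s₁ → r₂ ≗ s₂ → weight p q r₁ r₂ ≈ weight p′ q′ s₁ s₂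
    weight-cong {p′ = p′} {q′} p≈p′ q≈q′ r₁≗s₁ r₂≗s₂ = *-cong
      (∏-cong (allFin (n₁ G)) (λ v → trans (p≈p′ _) (reflexive (cong p′ (r₁≗s₁ v)))))
      (∏-cong (allFin (n₂ G)) (λ v → trans (q≈q′ _) (reflexive (cong q′ (r₂≗s₂ v)))))

    weight-zeroˡ : ∀ (p q : Fin m → Carrier) r₁ r₂ v → p (r₁ v) ≈ 0# → weight p q r₁ r₂ ≈ 0#
    weight-zeroˡ p q r₁ r₂ v p≈0 = trans (*-congʳ (∏-zero (∈-allFin v) p≈0)) (zeroˡ _)

    weight-zeroʳ : ∀ (p q : Fin m → Carrier) r₁ r₂ v → q (r₂ v) ≈ 0# → weight p q r₁ r₂ ≈ 0#
    weight-zeroʳ p q r₁ r₂ v q≈0 = trans (*-congˡ (∏-zero (∈-allFin v) q≈0)) (zeroʳ _)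

    summand-zeroˡ : ∀ (p q : Fin m → Carrier) r₁ r₂ v → p (r₁ v) ≈ 0# → summand p q r₁ r₂ ≈ 0#
    summand-zeroˡ p q r₁ r₂ v p≈0 = when-0 (orderCond G r₁ r₂) (weight-zeroˡ p q r₁ r₂ v p≈0)

    summand-zeroʳ : ∀ (p q : Fin m → Carrier) r₁ r₂ v → q (r₂ v) ≈ 0# → summand p q r₁ r₂ ≈ 0#
    summand-zeroʳ p q r₁ r₂ v q≈0 = when-0 (orderCond G r₁ r₂) (weight-zeroʳ p q r₁ r₂ v q≈0)

    summand-cong : ∀ {p q p′ q′ : Fin m → Carrier} {r₁ r₂} → (∀ a → p a ≈ p′ a) → (∀ a → q a ≈ q′ a) →
      summand p q r₁ r₂ ≈ summand p′ q′ r₁ r₂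
    summand-cong {r₁ = r₁} {r₂} p≈p′ q≈q′ =
      when-cong (orderCond G r₁ r₂) (weight-cong p≈p′ q≈q′ (λ _ → ≡.refl) (λ _ → ≡.refl))

    summand-≗ : ∀ (p q : Fin m → Carrier) {r₁ s₁ r₂ s₂} → r₁ ≗ s₁ → r₂ ≗ s₂ →
      summand p q r₁ r₂ ≈ summand p q s₁ s₂
    summand-≗ p q {r₁} {s₁} {r₂} {s₂} r₁≗s₁ r₂≗s₂ =
      trans (when-cong (orderCond G r₁ r₂) (weight-cong {p = p} {q} (λ _ → refl) (λ _ → refl) r₁≗s₁ r₂≗s₂))
            (reflexive (cong (λ b → when b (weight p q s₁ s₂)) (orderCond-cong-≗ G r₁≗s₁ r₂≗s₂)))

    summand-zero-E₁₂ : ∀ (p q : Fin m → Carrier) r₁ r₂ {v₁ v₂} → E₁₂ G v₁ v₂ ≡ true →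
      (r₁ v₁ ≤ r₂ v₂ → weight p q r₁ r₂ ≈ 0#) → summand p q r₁ r₂ ≈ 0#
    summand-zero-E₁₂ p q r₁ r₂ e forced with orderCond G r₁ r₂ in oc
    ... | false = refl
    ... | true  = forced (orderCond-E₁₂ G {r₁ = r₁} {r₂} e (subst T (≡.sym oc) _))

    summand-punchIn : ∀ (z : Fin (suc k)) (p q : Fin (suc k) → Carrier) r₁ r₂ →
      summand p q (punchIn z ∘ r₁) (punchIn z ∘ r₂) ≡ summand (p ∘ punchIn z) (q ∘ punchIn z) r₁ r₂
    summand-punchIn z p q r₁ r₂ = cong (λ b → when b (weight p q (punchIn z ∘ r₁) (punchIn z ∘ r₂)))
      (orderCond-cong G (punchIn z ∘ r₁) (punchIn z ∘ r₂) r₁ r₂ (λ v₁ v₂ →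
        mk⇔ (punchIn-cancel-≤ z _ _) (punchIn-mono-≤ z _ _)))

    summand-pinch : ∀ (i : Fin k) (p q : Fin (suc k) → Carrier) r₁ r₂ →
      (∀ v₁ v₂ → r₁ v₁ ≡ suc i → r₂ v₂ ≡ inject₁ i → weight p q r₁ r₂ ≈ 0#) →
      summand p q r₁ r₂ ≈ when (orderCond G (pinch i ∘ r₁) (pinch i ∘ r₂)) (weight p q r₁ r₂)
    summand-pinch i p q r₁ r₂ merged⇒0 with any? (λ v → r₁ v ≟ suc i) | any? (λ v → r₂ v ≟ inject₁ i)
    ... | yes (v₁ , e₁) | yes (v₂ , e₂) = let w≈0 = merged⇒0 v₁ v₂ e₁ e₂ in
      trans (when-0 (orderCond G r₁ r₂) w≈0) (sym (when-0 _ w≈0))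
    ... | no ¬e₁ | _      =
      reflexive (cong (λ b → when b _) (orderCond-pinch G i (λ v₁ v₂ (e₁ , _) → ¬e₁ (v₁ , e₁))))
    ... | yes _  | no ¬e₂ =
      reflexive (cong (λ b → when b _) (orderCond-pinch G i (λ v₁ v₂ (_ , e₂) → ¬e₂ (v₂ , e₂))))

    eval-N-cong : ∀ {p q p′ q′ : Fin m → Carrier} → (∀ a → p a ≈ p′ a) → (∀ a → q a ≈ q′ a) →
      eval R (N G m) p q ≈ eval R (N G m) p′ q′
    eval-N-cong {m} {p} {q} {p′} {q′} p≈p′ q≈q′ = begin
      eval R (N G m) p q                                          ≈⟨ eval-N p q ⟩
      ∑[ r₁ ∈ ranks₁ m ] ∑[ r₂ ∈ ranks₂ m ] summand p q r₁ r₂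
        ≈⟨ ∑-cong (ranks₁ m) (λ r₁ → ∑-cong (ranks₂ m) (λ r₂ → summand-cong p≈p′ q≈q′)) ⟩
      ∑[ r₁ ∈ ranks₁ m ] ∑[ r₂ ∈ ranks₂ m ] summand p′ q′ r₁ r₂  ≈⟨ sym (eval-N p′ q′) ⟩
      eval R (N G m) p′ q′                                        ∎

    eval-N-punchIn : ∀ (z : Fin (suc k)) (p q : Fin (suc k) → Carrier) →
      (∀ r₁ r₂ v → r₁ v ≡ z → summand p q r₁ r₂ ≈ 0#) → (∀ r₁ r₂ v → r₂ v ≡ z → summand p q r₁ r₂ ≈ 0#) →
      eval R (N G (suc k)) p q ≈ eval R (N G k) (p ∘ punchIn z) (q ∘ punchIn z)
    eval-N-punchIn {k} z p q vanish₁ vanish₂ = begin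
      eval R (N G (suc k)) p q
        ≈⟨ eval-N p q ⟩
      ∑[ r₁ ∈ ranks₁ (suc k) ] ∑[ r₂ ∈ ranks₂ (suc k) ] summand p q r₁ r₂
        ≈⟨ ∑-cong (ranks₁ (suc k)) (λ r₁ →
             ∑-allFuns-punchIn (n₂ G) z (summand p q r₁) (summand-≗ p q (λ _ → ≡.refl)) (vanish₂ r₁)) ⟩
      ∑[ r₁ ∈ ranks₁ (suc k) ] ∑[ r₂ ∈ ranks₂ k ] summand p q r₁ (punchIn z ∘ r₂)
        ≈⟨ ∑-allFuns-punchIn (n₁ G) z _
             (λ r₁≗s₁ → ∑-cong (ranks₂ k) (λ r₂ → summand-≗ p q r₁≗s₁ (λ _ → ≡.refl)))
             (λ r₁ v e → ∑-0 (ranks₂ k) (λ r₂ → vanish₁ r₁ _ v e)) ⟩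
      ∑[ r₁ ∈ ranks₁ k ] ∑[ r₂ ∈ ranks₂ k ] summand p q (punchIn z ∘ r₁) (punchIn z ∘ r₂)
        ≈⟨ ∑-cong (ranks₁ k) (λ r₁ → ∑-cong (ranks₂ k) (λ r₂ → reflexive (summand-punchIn z p q r₁ r₂))) ⟩
      ∑[ r₁ ∈ ranks₁ k ] ∑[ r₂ ∈ ranks₂ k ] summand (p ∘ punchIn z) (q ∘ punchIn z) r₁ r₂
        ≈⟨ sym (eval-N _ _) ⟩
      eval R (N G k) (p ∘ punchIn z) (q ∘ punchIn z) ∎

    ∑-fibre-summand : ∀ (κ : Fin m → Fin k) (p q : Fin m → Carrier) →
      (∀ r₁ r₂ → summand p q r₁ r₂ ≈ when (orderCond G (κ ∘ r₁) (κ ∘ r₂)) (weight p q r₁ r₂)) → ∀ s₁ s₂ →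
      ∑[ r₁ ∈ ranks₁ m ] ∑[ r₂ ∈ ranks₂ m ] (δᶠ (κ ∘ r₁) s₁ * (δᶠ (κ ∘ r₂) s₂ * summand p q r₁ r₂))
        ≈ summand (push κ p) (push κ q) s₁ s₂
    ∑-fibre-summand {m} κ p q same s₁ s₂ = begin
      ∑[ r₁ ∈ ranks₁ m ] ∑[ r₂ ∈ ranks₂ m ] (δᶠ (κ ∘ r₁) s₁ * (δᶠ (κ ∘ r₂) s₂ * summand p q r₁ r₂))
        ≈⟨ ∑-cong (ranks₁ m) (λ r₁ → ∑-cong (ranks₂ m) (fibrewise r₁)) ⟩
      ∑[ r₁ ∈ ranks₁ m ] ∑[ r₂ ∈ ranks₂ m ] when c (P r₁ * Q r₂)
        ≈⟨ trans (∑-cong (ranks₁ m) (λ r₁ → ∑-when c (ranks₂ m))) (∑-when c (ranks₁ m)) ⟩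
      when c (∑[ r₁ ∈ ranks₁ m ] ∑[ r₂ ∈ ranks₂ m ] (P r₁ * Q r₂))
        ≈⟨ when-cong c (trans (∑∑-* (ranks₁ m) (ranks₂ m)) (*-cong (∑-fibre-∏ κ p s₁) (∑-fibre-∏ κ q s₂))) ⟩
      summand (push κ p) (push κ q) s₁ s₂ ∎
      where
      c = orderCond G s₁ s₂
      P = λ r₁ → δᶠ (κ ∘ r₁) s₁ * ∏[ v ∈ allFin (n₁ G) ] p (r₁ v)
      Q = λ r₂ → δᶠ (κ ∘ r₂) s₂ * ∏[ v ∈ allFin (n₂ G) ] q (r₂ v)
      fibrewise : ∀ r₁ r₂ → δᶠ (κ ∘ r₁) s₁ * (δᶠ (κ ∘ r₂) s₂ * summand p q r₁ r₂) ≈ when c (P r₁ * Q r₂)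
      fibrewise r₁ r₂ = begin
        δᶠ (κ ∘ r₁) s₁ * (δᶠ (κ ∘ r₂) s₂ * summand p q r₁ r₂)
          ≈⟨ *-congˡ (*-congˡ (same r₁ r₂)) ⟩
        δᶠ (κ ∘ r₁) s₁ * (δᶠ (κ ∘ r₂) s₂ * when (orderCond G (κ ∘ r₁) (κ ∘ r₂)) (weight p q r₁ r₂))
          ≈⟨ δᶠ-guard (κ ∘ r₁) s₁ (λ κr₁≗s₁ → δᶠ-guard (κ ∘ r₂) s₂ (λ κr₂≗s₂ →
               reflexive (cong (λ b → when b (weight p q r₁ r₂)) (orderCond-cong-≗ G κr₁≗s₁ κr₂≗s₂)))) ⟩
        δᶠ (κ ∘ r₁) s₁ * (δᶠ (κ ∘ r₂) s₂ * when c (weight p q r₁ r₂))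
          ≈⟨ *-when-interchange c _ _ _ _ ⟩
        when c (P r₁ * Q r₂) ∎

    eval-N-push : ∀ (κ : Fin m → Fin k) (p q : Fin m → Carrier) →
      (∀ r₁ r₂ → summand p q r₁ r₂ ≈ when (orderCond G (κ ∘ r₁) (κ ∘ r₂)) (weight p q r₁ r₂)) →
      eval R (N G m) p q ≈ eval R (N G k) (push κ p) (push κ q)
    eval-N-push {m} {k} κ p q same = begin
      eval R (N G m) p q
        ≈⟨ eval-N p q ⟩
      ∑[ r₁ ∈ ranks₁ m ] ∑[ r₂ ∈ ranks₂ m ] summand p q r₁ r₂
        ≈⟨ ∑∑-fibres κ (summand p q) ⟩
      ∑[ s₁ ∈ ranks₁ k ] ∑[ s₂ ∈ ranks₂ k ] ∑[ r₁ ∈ ranks₁ m ] ∑[ r₂ ∈ ranks₂ m ]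
        (δᶠ (κ ∘ r₁) s₁ * (δᶠ (κ ∘ r₂) s₂ * summand p q r₁ r₂))
        ≈⟨ ∑-cong (ranks₁ k) (λ s₁ → ∑-cong (ranks₂ k) (∑-fibre-summand κ p q same s₁)) ⟩
      ∑[ s₁ ∈ ranks₁ k ] ∑[ s₂ ∈ ranks₂ k ] summand (push κ p) (push κ q) s₁ s₂
        ≈⟨ sym (eval-N _ _) ⟩
      eval R (N G k) (push κ p) (push κ q) ∎

    N-stable : ∀ m (p q : Fin (suc m) → Carrier) →
      eval R (N G (suc m)) (setZero R p (fromℕ m)) (setZero R q (fromℕ m))
        ≈ eval R (N G m) (λ j → p (inject₁ j)) (λ j → q (inject₁ j))
    N-stable m p q = trans
      (eval-N-punchIn (fromℕ m) p₀ q₀ (λ r₁ r₂ v e → summand-zeroˡ p₀ q₀ r₁ r₂ v (reflexive (setZero-≡ p e)))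
                                      (λ r₁ r₂ v e → summand-zeroʳ p₀ q₀ r₁ r₂ v (reflexive (setZero-≡ q e))))
      (eval-N-cong (reflexive ∘ setZero-last p) (reflexive ∘ setZero-last q))
      where
      p₀ = setZero R p (fromℕ m)
      q₀ = setZero R q (fromℕ m)

    N-condQ : ∀ k (p q : Fin (suc k) → Carrier) (i : Fin k) →
      eval R (N G (suc k)) p (setZero R q (inject₁ i)) ≈ eval R (N G k) (mergeAt R p i) (remove R q (inject₁ i))
    N-condQ k p q i = trans
      (eval-N-push (pinch i) p q₀ (λ r₁ r₂ → summand-pinch i p q₀ r₁ r₂ (λ v₁ v₂ _ e₂ →
        weight-zeroʳ p q₀ r₁ r₂ v₂ (reflexive (setZero-≡ q e₂)))))
      (eval-N-cong (λ b → sym (mergeAt-push p i b))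
                   (λ b → trans (sym (mergeAt-push q₀ i b)) (mergeAt-setZero-inject₁ q i b)))
      where q₀ = setZero R q (inject₁ i)

    N-condP : ∀ k (p q : Fin (suc k) → Carrier) (i : Fin k) →
      eval R (N G (suc k)) (setZero R p (suc i)) q ≈ eval R (N G k) (remove R p (suc i)) (mergeAt R q i)
    N-condP k p q i = trans
      (eval-N-push (pinch i) p₀ q (λ r₁ r₂ → summand-pinch i p₀ q r₁ r₂ (λ v₁ v₂ e₁ _ →
        weight-zeroˡ p₀ q r₁ r₂ v₁ (reflexive (setZero-≡ p e₁)))))
      (eval-N-cong (λ b → trans (sym (mergeAt-push p₀ i b)) (mergeAt-setZero-suc p i b))
                   (λ b → sym (mergeAt-push q i b)))
      where p₀ = setZero R p (suc i)

    N-condQ-last : EveryVertexInE₁₂ G → ∀ k (p q : Fin (suc k) → Carrier) →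
      eval R (N G (suc k)) p (setZero R q (fromℕ k)) ≈ eval R (N G k) (λ j → p (inject₁ j)) (λ j → q (inject₁ j))
    N-condQ-last (cover₁ , _) k p q = trans
      (eval-N-punchIn (fromℕ k) p q₀ top₁ (λ r₁ r₂ v e → summand-zeroʳ p q₀ r₁ r₂ v (reflexive (setZero-≡ q e))))
      (eval-N-cong (λ j → reflexive (cong p (punchIn-fromℕ j))) (reflexive ∘ setZero-last q))
      where
      q₀ = setZero R q (fromℕ k)
      top₁ : ∀ r₁ r₂ v₁ → r₁ v₁ ≡ fromℕ k → summand p q₀ r₁ r₂ ≈ 0#
      top₁ r₁ r₂ v₁ e = let v₂ , edge = cover₁ v₁ in summand-zero-E₁₂ p q₀ r₁ r₂ edge (λ r₁v₁≤r₂v₂ →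
        weight-zeroʳ p q₀ r₁ r₂ v₂ (reflexive (setZero-≡ q
          (Fin.≤-antisym (≤fromℕ (r₂ v₂)) (subst (_≤ r₂ v₂) e r₁v₁≤r₂v₂)))))

    N-condP-first : EveryVertexInE₁₂ G → ∀ k (p q : Fin (suc k) → Carrier) →
      eval R (N G (suc k)) (setZero R p zero) q ≈ eval R (N G k) (λ j → p (suc j)) (λ j → q (suc j))
    N-condP-first (_ , cover₂) k p q =
      eval-N-punchIn zero p₀ q (λ r₁ r₂ v e → summand-zeroˡ p₀ q r₁ r₂ v (reflexive (setZero-≡ p e))) bottom₂
      where
      p₀ = setZero R p zero
      bottom₂ : ∀ r₁ r₂ v₂ → r₂ v₂ ≡ zero → summand p₀ q r₁ r₂ ≈ 0#
      bottom₂ r₁ r₂ v₂ e = let v₁ , edge = cover₂ v₂ in summand-zero-E₁₂ p₀ q r₁ r₂ edge (λ r₁v₁≤r₂v₂ →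
        weight-zeroˡ p₀ q r₁ r₂ v₁ (reflexive (setZero-≡ p
          (Fin.≤-antisym (subst (r₁ v₁ ≤_) e r₁v₁≤r₂v₂) z≤n))))

deg-≤ : ∀ {d} {xs : Poly m} → All (λ mon → length mon ℕ.≤ d) xs → deg xs ℕ.≤ d
deg-≤ []         = z≤n
deg-≤ (px ∷ pxs) = ℕ.⊔-lub px (deg-≤ pxs)

length-monomialOf : ∀ G (r₁ : Fin (n₁ G) → Fin m) r₂ → length (monomialOf G r₁ r₂) ≡ n₁ G ℕ.+ n₂ G
length-monomialOf G r₁ r₂ = ≡.trans (length-++ (map (pv ∘ r₁) (allFin (n₁ G))))
  (cong₂ ℕ._+_ (≡.trans (length-map _ (allFin (n₁ G))) (length-tabulate {n = n₁ G} id))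
               (≡.trans (length-map _ (allFin (n₂ G))) (length-tabulate {n = n₂ G} id)))

deg-N : ∀ G m → deg (N G m) ℕ.≤ n₁ G ℕ.+ n₂ G
deg-N G m = deg-≤ (concat⁺ (map⁺ (universal (λ r₁ → map⁺ (universal (λ r₂ →
  ℕ.≤-reflexive (length-monomialOf G r₁ r₂)) (filterᵇ (orderCond G r₁) (allFuns (n₂ G) m))))
  (allFuns (n₁ G) m))))

lemma4p13 : (G : BipGraph) → EveryVertexInE₁₂ G → Sol′ (N G)
lemma4p13 G cover =
    (n₁ G ℕ.+ n₂ G , deg-N G)
  , (λ R → N-stable R G)
  , (λ R k p q → N-condQ R G k p q , N-condQ-last R G cover k p q)
  , (λ R k p q → N-condP R G k p q , N-condP-first R G cover k p q)
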